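{- For every $\epsilon>0$ there is an instance of MIVC on a bipartite graph (i.e., MWBIS with $w(v)=\deg(v)$ for all $v$) for which the ratio of the optimum value of the integer program below to the optimum value of its linear programming relaxation is at most $\frac12+\epsilon$. Here, for a graph $G$ with $V(G)=\{v_1,\dots,v_n\}$, weight $w$ and budget $k$, with $\mathcal{C}$ the set of all maximal cliques of $G$, the integer program is: maximize $\sum_{i\in[n]}w(v_i)x_i$ subject to $\sum_{i=1}^n x_i\le k$, $\sum_{i: v_i\in C}x_i\le 1$ for all $C\in\mathcal{C}$, and $x_i\in\{0,1\}$ for all $i$; its LP relaxation replaces $x_i\in\{0,1\}$ by $x_i\ge 0$. In other words, the integrality gap of this LP relaxation for MWBIS on bipartite graphs is at most $\frac12+\epsilon$ for every $\epsilon>0$.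
   Context: MWBIS: given a graph $G$, $w:V(G)\to\mathbb{R}^+$ and a positive integer $k$, find an independent set of size at most $k$ of maximum total weight. MIVC is the special case $w(v)=\deg(v)$. $[n]=\{1,\dots,n\}$.
   Formalization: The parameter ε ranges only over the positive rationals, and the solution vector of the LP relaxation is taken in ℚ^n. -}

module Defs where

open import Data.Bool using (Bool; true; false; if_then_else_)
open import Data.Nat using (ℕ; zero; suc)
open import Data.Fin using (Fin)
open import Data.Fin.Subset using (Subset; _∈_; _⊆_)
open import Data.Integer using (+_)
open import Data.Rational using (ℚ; 0ℚ; 1ℚ; _+_; _*_; _≤_; _/_)
open import Data.Product using (_×_)
open import Relation.Binary.PropositionalEquality using (_≡_; _≢_)

record Graph (n : ℕ) : Set where
  field
    Adj   : Fin n → Fin n → Bool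
    irrefl : ∀ i → Adj i i ≡ false
    sym   : ∀ i j → Adj i j ≡ Adj j i
open Graph public

sumFin : {n : ℕ} → (Fin n → ℚ) → ℚ
sumFin {zero}  f = 0ℚ
sumFin {suc n} f = f Fin.zero + sumFin (λ i → f (Fin.suc i))

ℕ→ℚ : ℕ → ℚ
ℕ→ℚ m = + m / 1

sumFinℕ : {n : ℕ} → (Fin n → ℕ) → ℕ
sumFinℕ {zero}  f = 0
sumFinℕ {suc n} f = f Fin.zero Data.Nat.+ sumFinℕ (λ i → f (Fin.suc i))

deg : {n : ℕ} → Graph n → Fin n → ℕ
deg G v = sumFinℕ (λ u → if Adj G v u then 1 else 0)

Bipartite : {n : ℕ} → Graph n → Set
Bipartite {n} G = Data.Product.Σ (Fin n → Bool) λ col →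
  ∀ i j → Adj G i j ≡ true → col i ≢ col j

IsClique : {n : ℕ} → Graph n → Subset n → Set
IsClique G C = ∀ i j → i ∈ C → j ∈ C → i ≢ j → Adj G i j ≡ true

IsMaximalClique : {n : ℕ} → Graph n → Subset n → Set
IsMaximalClique {n} G C = IsClique G C × (∀ (D : Subset n) → IsClique G D → C ⊆ D → D ⊆ C)

sumOver : {n : ℕ} → Subset n → (Fin n → ℚ) → ℚ
sumOver {n} C x = sumFin (λ i → if Data.Vec.lookup C i then x i else 0ℚ)
  where import Data.Vec

objective : {n : ℕ} → Graph n → (Fin n → ℚ) → ℚ
objective G x = sumFin (λ i → ℕ→ℚ (deg G i) * x i)

CommonConstraints : {n : ℕ} → Graph n → ℕ → (Fin n → ℚ) → Set
CommonConstraints {n} G k x =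
  (sumFin x ≤ ℕ→ℚ k) × (∀ (C : Subset n) → IsMaximalClique G C → sumOver C x ≤ 1ℚ)

LPFeasible : {n : ℕ} → Graph n → ℕ → (Fin n → ℚ) → Set
LPFeasible G k x = (∀ i → 0ℚ ≤ x i) × CommonConstraints G k x

bool→ℚ : Bool → ℚ
bool→ℚ true = 1ℚ
bool→ℚ false = 0ℚ

IPFeasible : {n : ℕ} → Graph n → ℕ → (Fin n → Bool) → Set
IPFeasible G k y = CommonConstraints G k (λ i → bool→ℚ (y i))

module Submission where

-- For M ≥ 1 let G_M be the tree with a hub u, B = (M+1)·M children v_b of
-- the hub, and M−1 leaves below every v_b; so deg u = B, deg v_b = M and
-- every leaf has degree 1.  Take the budget k = M+1.
--
-- * LP side: x_u = M/(M+1), x_{v_b} = 1/(M+1), x_leaf = 0.  A clique of a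
--   bipartite graph holds at most one vertex of each colour, so every clique
--   constraint is at most M/(M+1) + 1/(M+1) = 1; the budget holds since
--   M + B ≤ (M+1)².  The objective is 2·B·M/(M+1) = 2M².
-- * IP side: in a bipartite graph every edge is a maximal clique, so a 0/1
--   solution is an independent set with at most M+1 vertices.  If it contains
--   u it avoids all v_b and gains at most B + M; otherwise every chosen vertex
--   has degree ≤ M and it gains at most M(M+1) ≤ B + M.
-- * Hence IP/LP ≤ (M² + 2M)/(2M²) = 1/2 + 1/M ≤ 1/2 + ε once ε·M ≥ 1, which
--   holds for M the denominator of ε.

open import Defs hiding (sym)
open import Data.Nat using (ℕ)
open import Data.Bool using (Bool)
open import Data.Fin using (Fin)
open import Data.Rational using (ℚ; 0ℚ; ½; _+_; _*_; _≤_; _<_)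
open import Data.Product using (Σ; _×_)

open import Data.Nat as ℕ using (zero; suc; z≤n; s≤s)
import Data.Nat.Properties as ℕ
open import Data.Nat.Tactic.RingSolver using (solve-∀)
open import Algebra.Properties.CommutativeSemigroup ℕ.+-commutativeSemigroup
  using () renaming (interchange to +-interchange)
open import Data.Nat.Coprimality using (1-coprimeTo)
import Data.Nat.Coprimality as Coprimality
open import Data.Integer as ℤ using (+_; +[1+_]; -[1+_])
import Data.Integer.Properties as ℤ
open import Data.Rational using (mkℚ; 1ℚ; _/_; 1/_; *≤*; *<*; ↧ₙ_; NonNegative)
import Data.Rational.Properties as ℚ
import Data.Rational.Unnormalised as ℚᵘ
import Data.Rational.Unnormalised.Properties as ℚᵘ
open import Data.Bool using (true; false; if_then_else_; not)
open import Data.Bool.Properties using (not-injective)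
open import Data.Fin as Fin using (_↑ˡ_; _↑ʳ_; combine; remQuot; _≟_)
open import Data.Fin.Properties using (remQuot-combine; suc-injective)
open import Data.Fin.Subset using (Subset; ⁅_⁆; _∪_; _∈_; _⊆_)
open import Data.Fin.Subset.Properties using (x∈⁅x⁆; x∈⁅y⁆⇒x≡y; x∈p∪q⁻; x∈p∪q⁺)
open import Data.Vec using (lookup)
open import Data.Vec.Properties using (lookup⇒[]=; []=⇒lookup)
open import Data.Product using (_,_; proj₁)
open import Data.Sum using (_⊎_; inj₁; inj₂)
open import Data.Empty using (⊥; ⊥-elim)
open import Function using (_∘_)
open import Relation.Nullary using (yes; no; does)
open import Relation.Nullary.Decidable using (dec-true; dec-false)
open import Relation.Binary.PropositionalEquality
  using (_≡_; _≢_; refl; sym; trans; cong; cong₂; subst; subst₂; module ≡-Reasoning)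

-- The normal form of the rational m/1.  Facts about ℕ→ℚ are proved by
-- rewriting into it, where arithmetic on rationals computes.
normalℚ : ℕ → ℚ
normalℚ m = mkℚ (+ m) 0 (Coprimality.sym (1-coprimeTo m))

ℕ→ℚ-normal : ∀ m → ℕ→ℚ m ≡ normalℚ m
ℕ→ℚ-normal m = ℚ.normalize-coprime (Coprimality.sym (1-coprimeTo m))

ℕ→ℚ-+ : ∀ a b → ℕ→ℚ (a ℕ.+ b) ≡ ℕ→ℚ a + ℕ→ℚ b
ℕ→ℚ-+ a b rewrite ℕ→ℚ-normal a | ℕ→ℚ-normal b =
  cong (λ z → z / 1) (trans (ℤ.pos-+ a b)
    (cong₂ ℤ._+_ (sym (ℤ.*-identityʳ (+ a))) (sym (ℤ.*-identityʳ (+ b)))))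

ℕ→ℚ-* : ∀ a b → ℕ→ℚ (a ℕ.* b) ≡ ℕ→ℚ a * ℕ→ℚ b
ℕ→ℚ-* a b rewrite ℕ→ℚ-normal a | ℕ→ℚ-normal b = cong (λ z → z / 1) (ℤ.pos-* a b)

ℕ→ℚ-mono : ∀ {a b} → a ℕ.≤ b → ℕ→ℚ a ≤ ℕ→ℚ b
ℕ→ℚ-mono {a} {b} a≤b rewrite ℕ→ℚ-normal a | ℕ→ℚ-normal b =
  *≤* (subst₂ ℤ._≤_ (sym (ℤ.*-identityʳ (+ a))) (sym (ℤ.*-identityʳ (+ b))) (ℤ.+≤+ a≤b))

ℕ→ℚ-cancel : ∀ {a b} → ℕ→ℚ a ≤ ℕ→ℚ b → a ℕ.≤ b
ℕ→ℚ-cancel {a} {b} a≤b rewrite ℕ→ℚ-normal a | ℕ→ℚ-normal b with a≤b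
... | *≤* a≤b′ = ℤ.drop‿+≤+ (subst₂ ℤ._≤_ (ℤ.*-identityʳ (+ a)) (ℤ.*-identityʳ (+ b)) a≤b′)

ℕ→ℚ-pos : ∀ {a} → 0 ℕ.< a → 0ℚ < ℕ→ℚ a
ℕ→ℚ-pos {suc a} _ rewrite ℕ→ℚ-normal (suc a) = *<* (ℤ.+<+ (s≤s z≤n))

ℕ→ℚ-nonNeg : ∀ a → NonNegative (ℕ→ℚ a)
ℕ→ℚ-nonNeg a = subst NonNegative (sym (ℕ→ℚ-normal a)) _

ε*denominator≥1 : ∀ ε → 0ℚ < ε → 1ℚ ≤ ε * ℕ→ℚ (↧ₙ ε)
ε*denominator≥1 ε@(mkℚ +[1+ p ] d _) _ rewrite ℕ→ℚ-normal (suc d) =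
  ℚ.toℚᵘ-cancel-≤ (ℚᵘ.≤-respʳ-≃ (ℚᵘ.≃-sym (ℚ.toℚᵘ-homo-* ε (normalℚ (suc d))))
    (ℚᵘ.*≤* (ℤ.+≤+ (s≤s d≤numerator))))
  where
  open ℕ.≤-Reasoning
  -- 1·(d+1) ≤ (p+1)·(d+1), with the unit factors left by the normal forms
  d≤numerator : d ℕ.* 1 ℕ.+ 0 ℕ.≤ (d ℕ.+ p ℕ.* suc d) ℕ.* 1
  d≤numerator = begin
    d ℕ.* 1 ℕ.+ 0            ≡⟨ trans (ℕ.+-identityʳ _) (ℕ.*-identityʳ d) ⟩
    d                        ≤⟨ ℕ.m≤m+n d (p ℕ.* suc d) ⟩
    d ℕ.+ p ℕ.* suc d        ≡⟨ sym (ℕ.*-identityʳ _) ⟩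
    (d ℕ.+ p ℕ.* suc d) ℕ.* 1 ∎
ε*denominator≥1 (mkℚ (+ 0) _ _) (*<* (ℤ.+<+ ()))
ε*denominator≥1 (mkℚ -[1+ _ ] _ _) (*<* ())

-- Division by m + 1, used to scale integral LP weights into [0, 1]; the
-- normal form of m + 1 is visibly non-zero, so it can be inverted.
inv-suc : ℕ → ℚ
inv-suc m = 1/ normalℚ (suc m)

÷suc-cancel : ∀ m a → ℕ→ℚ (a ℕ.* suc m) * inv-suc m ≡ ℕ→ℚ a
÷suc-cancel m a = begin
  ℕ→ℚ (a ℕ.* suc m) * inv-suc m          ≡⟨ cong (_* inv-suc m) (ℕ→ℚ-* a (suc m)) ⟩
  ℕ→ℚ a * ℕ→ℚ (suc m) * inv-suc m        ≡⟨ ℚ.*-assoc (ℕ→ℚ a) (ℕ→ℚ (suc m)) (inv-suc m) ⟩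
  ℕ→ℚ a * (ℕ→ℚ (suc m) * inv-suc m)      ≡⟨ cong (λ s → ℕ→ℚ a * (s * inv-suc m)) (ℕ→ℚ-normal (suc m)) ⟩
  ℕ→ℚ a * (normalℚ (suc m) * inv-suc m)  ≡⟨ cong (ℕ→ℚ a *_) (ℚ.*-inverseʳ (normalℚ (suc m))) ⟩
  ℕ→ℚ a * 1ℚ                             ≡⟨ ℚ.*-identityʳ (ℕ→ℚ a) ⟩
  ℕ→ℚ a                                  ∎
  where open ≡-Reasoning

÷suc-≤ : ∀ m {a b} → a ℕ.≤ b ℕ.* suc m → ℕ→ℚ a * inv-suc m ≤ ℕ→ℚ b
÷suc-≤ m {a} {b} a≤b = subst (ℕ→ℚ a * inv-suc m ≤_) (÷suc-cancel m b)
  (ℚ.*-monoʳ-≤-nonNeg (inv-suc m) (ℕ→ℚ-mono a≤b))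

÷suc-nonNeg : ∀ m a → 0ℚ ≤ ℕ→ℚ a * inv-suc m
÷suc-nonNeg m a = subst (_≤ ℕ→ℚ a * inv-suc m) (ℚ.*-zeroˡ (inv-suc m))
  (ℚ.*-monoʳ-≤-nonNeg (inv-suc m) (ℕ→ℚ-mono {0} {a} z≤n))

𝟙 : Bool → ℕ
𝟙 b = if b then 1 else 0

sum-cong : ∀ {n} {f g : Fin n → ℕ} → (∀ i → f i ≡ g i) → sumFinℕ f ≡ sumFinℕ g
sum-cong {zero}  f≡g = refl
sum-cong {suc n} f≡g = cong₂ ℕ._+_ (f≡g Fin.zero) (sum-cong (λ i → f≡g (Fin.suc i)))

sum-mono : ∀ {n} {f g : Fin n → ℕ} → (∀ i → f i ℕ.≤ g i) → sumFinℕ f ℕ.≤ sumFinℕ g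
sum-mono {zero}  f≤g = z≤n
sum-mono {suc n} f≤g = ℕ.+-mono-≤ (f≤g Fin.zero) (sum-mono (λ i → f≤g (Fin.suc i)))

sum-const : ∀ n c → sumFinℕ {n} (λ _ → c) ≡ n ℕ.* c
sum-const zero    c = refl
sum-const (suc n) c = cong (c ℕ.+_) (sum-const n c)

sum-zero : ∀ {n} {f : Fin n → ℕ} → (∀ i → f i ≡ 0) → sumFinℕ f ≡ 0
sum-zero {n} f≡0 = trans (sum-cong f≡0) (trans (sum-const n 0) (ℕ.*-zeroʳ n))

sum-+ : ∀ {n} (f g : Fin n → ℕ) →
  sumFinℕ (λ i → f i ℕ.+ g i) ≡ sumFinℕ f ℕ.+ sumFinℕ g
sum-+ {zero}  f g = refl
sum-+ {suc n} f g = trans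
  (cong (f Fin.zero ℕ.+ g Fin.zero ℕ.+_) (sum-+ (λ i → f (Fin.suc i)) (λ i → g (Fin.suc i))))
  (+-interchange (f Fin.zero) (g Fin.zero) _ _)

sum-scale : ∀ {n} c (f : Fin n → ℕ) → sumFinℕ (λ i → c ℕ.* f i) ≡ c ℕ.* sumFinℕ f
sum-scale {zero}  c f = sym (ℕ.*-zeroʳ c)
sum-scale {suc n} c f = trans (cong (c ℕ.* f Fin.zero ℕ.+_) (sum-scale c (λ i → f (Fin.suc i))))
  (sym (ℕ.*-distribˡ-+ c (f Fin.zero) _))

sum-split : ∀ m {n} (f : Fin (m ℕ.+ n) → ℕ) →
  sumFinℕ f ≡ sumFinℕ (λ i → f (i ↑ˡ n)) ℕ.+ sumFinℕ (λ i → f (m ↑ʳ i))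
sum-split zero    f = refl
sum-split (suc m) f = trans (cong (f Fin.zero ℕ.+_) (sum-split m (λ i → f (Fin.suc i))))
  (sym (ℕ.+-assoc (f Fin.zero) _ _))

sum-combine : ∀ B {M} (f : Fin (B ℕ.* M) → ℕ) →
  sumFinℕ f ≡ sumFinℕ {B} (λ b → sumFinℕ {M} (λ r → f (combine b r)))
sum-combine zero        f = refl
sum-combine (suc B) {M} f = trans (sum-split M f)
  (cong (sumFinℕ (λ r → f (r ↑ˡ (B ℕ.* M))) ℕ.+_) (sum-combine B (λ i → f (M ↑ʳ i))))

sum-partition : ∀ {n} (t : Fin n → Bool) (f : Fin n → ℕ) →
  sumFinℕ f ≡ sumFinℕ (λ i → if t i then f i else 0) ℕ.+ sumFinℕ (λ i → if not (t i) then f i else 0)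
sum-partition t f = trans (sum-cong split)
  (sum-+ (λ i → if t i then f i else 0) (λ i → if not (t i) then f i else 0))
  where
  split : ∀ i → f i ≡ (if t i then f i else 0) ℕ.+ (if not (t i) then f i else 0)
  split i with t i
  ... | true  = sym (ℕ.+-identityʳ (f i))
  ... | false = refl

sum-point : ∀ {n} (f : Fin n → ℕ) (b : Fin n) → (∀ i → i ≢ b → f i ≡ 0) → sumFinℕ f ≡ f b
sum-point f Fin.zero    vanish =
  trans (cong (f Fin.zero ℕ.+_) (sum-zero {f = λ i → f (Fin.suc i)} (λ i → vanish (Fin.suc i) λ ())))
        (ℕ.+-identityʳ (f Fin.zero))
sum-point f (Fin.suc b) vanish =
  trans (cong (ℕ._+ sumFinℕ (λ i → f (Fin.suc i))) (vanish Fin.zero λ ()))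
  (sum-point (λ i → f (Fin.suc i)) b (λ i i≢b → vanish (Fin.suc i) (λ e → i≢b (suc-injective e))))

sum-≤-single : ∀ {n a} (f : Fin n → ℕ) → (∀ i j → 0 ℕ.< f i → 0 ℕ.< f j → i ≡ j) →
  (∀ i → f i ℕ.≤ a) → sumFinℕ f ℕ.≤ a
sum-≤-single {zero}  f unique bound = z≤n
sum-≤-single {suc n} {a} f unique bound with f Fin.zero in f₀≡
... | zero  = sum-≤-single (λ i → f (Fin.suc i))
                (λ i j fᵢ>0 fⱼ>0 → suc-injective (unique _ _ fᵢ>0 fⱼ>0)) (λ i → bound (Fin.suc i))
... | suc m = begin
  suc m ℕ.+ sumFinℕ (λ i → f (Fin.suc i)) ≡⟨ cong (suc m ℕ.+_) (sum-zero tail-zero) ⟩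
  suc m ℕ.+ 0                             ≡⟨ ℕ.+-identityʳ (suc m) ⟩
  suc m                                   ≡⟨ sym f₀≡ ⟩
  f Fin.zero                              ≤⟨ bound Fin.zero ⟩
  a                                       ∎
  where
  open ℕ.≤-Reasoning
  tail-zero : ∀ i → f (Fin.suc i) ≡ 0
  tail-zero i with f (Fin.suc i) in fᵢ≡
  ... | zero  = refl
  ... | suc _ with unique Fin.zero (Fin.suc i)
                     (subst (0 ℕ.<_) (sym f₀≡) (s≤s z≤n)) (subst (0 ℕ.<_) (sym fᵢ≡) (s≤s z≤n))
  ... | ()

term≤sum : ∀ {n} (f : Fin n → ℕ) i → f i ℕ.≤ sumFinℕ f
term≤sum f Fin.zero    = ℕ.m≤m+n _ _
term≤sum f (Fin.suc i) = ℕ.≤-trans (term≤sum (λ j → f (Fin.suc j)) i) (ℕ.m≤n+m _ (f Fin.zero))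

pair≤sum : ∀ {n} (f : Fin n → ℕ) i j → i ≢ j → f i ℕ.+ f j ℕ.≤ sumFinℕ f
pair≤sum f Fin.zero    Fin.zero    i≢j = ⊥-elim (i≢j refl)
pair≤sum f Fin.zero    (Fin.suc j) i≢j = ℕ.+-monoʳ-≤ (f Fin.zero) (term≤sum (λ l → f (Fin.suc l)) j)
pair≤sum f (Fin.suc i) Fin.zero    i≢j = subst (ℕ._≤ sumFinℕ f) (ℕ.+-comm (f Fin.zero) (f (Fin.suc i)))
  (ℕ.+-monoʳ-≤ (f Fin.zero) (term≤sum (λ l → f (Fin.suc l)) i))
pair≤sum f (Fin.suc i) (Fin.suc j) i≢j = ℕ.≤-trans
  (pair≤sum (λ l → f (Fin.suc l)) i j (λ i≡j → i≢j (cong Fin.suc i≡j))) (ℕ.m≤n+m _ (f Fin.zero))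

weighted-count : ∀ {n a} (d : Fin n → ℕ) (y : Fin n → Bool) → (∀ i → y i ≡ true → d i ℕ.≤ a) →
  sumFinℕ (λ i → d i ℕ.* 𝟙 (y i)) ℕ.≤ a ℕ.* sumFinℕ (λ i → 𝟙 (y i))
weighted-count {a = a} d y bound = ℕ.≤-trans (sum-mono term) (ℕ.≤-reflexive (sum-scale a (λ i → 𝟙 (y i))))
  where
  term : ∀ i → d i ℕ.* 𝟙 (y i) ℕ.≤ a ℕ.* 𝟙 (y i)
  term i with y i in yᵢ
  ... | true  = ℕ.*-monoˡ-≤ 1 (bound i yᵢ)
  ... | false = ℕ.≤-reflexive (trans (ℕ.*-zeroʳ (d i)) (sym (ℕ.*-zeroʳ a)))

sumFin-cong : ∀ {n} {p q : Fin n → ℚ} → (∀ i → p i ≡ q i) → sumFin p ≡ sumFin q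
sumFin-cong {zero}  p≡q = refl
sumFin-cong {suc n} p≡q = cong₂ _+_ (p≡q Fin.zero) (sumFin-cong (λ i → p≡q (Fin.suc i)))

sumFin-ℕ : ∀ {n} (g : Fin n → ℕ) → sumFin (λ i → ℕ→ℚ (g i)) ≡ ℕ→ℚ (sumFinℕ g)
sumFin-ℕ {zero}  g = refl
sumFin-ℕ {suc n} g = trans (cong (λ s → ℕ→ℚ (g Fin.zero) + s) (sumFin-ℕ (λ i → g (Fin.suc i))))
  (sym (ℕ→ℚ-+ (g Fin.zero) _))

sumFin-*ʳ : ∀ {n} (q : Fin n → ℚ) β → sumFin (λ i → q i * β) ≡ sumFin q * β
sumFin-*ʳ {zero}  q β = sym (ℚ.*-zeroˡ β)
sumFin-*ʳ {suc n} q β = trans (cong (λ s → q Fin.zero * β + s) (sumFin-*ʳ (λ i → q (Fin.suc i)) β))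
  (sym (ℚ.*-distribʳ-+ β (q Fin.zero) _))

sumOn : ∀ {n} → Subset n → (Fin n → ℕ) → ℕ
sumOn C c = sumFinℕ (λ i → if lookup C i then c i else 0)

degWeight : ∀ {n} → Graph n → (Fin n → ℕ) → ℕ
degWeight G c = sumFinℕ (λ i → deg G i ℕ.* c i)

module Scaled {n} (x : Fin n → ℚ) (c : Fin n → ℕ) (β : ℚ) (x≡ : ∀ i → x i ≡ ℕ→ℚ (c i) * β) where

  private
    scaled-sum : ∀ (g : Fin n → ℕ) → sumFin (λ i → ℕ→ℚ (g i) * β) ≡ ℕ→ℚ (sumFinℕ g) * β
    scaled-sum g = trans (sumFin-*ʳ (λ i → ℕ→ℚ (g i)) β) (cong (_* β) (sumFin-ℕ g))

  total : sumFin x ≡ ℕ→ℚ (sumFinℕ c) * β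
  total = trans (sumFin-cong x≡) (scaled-sum c)

  onSubset : ∀ C → sumOver C x ≡ ℕ→ℚ (sumOn C c) * β
  onSubset C = trans (sumFin-cong restrict) (scaled-sum (λ i → if lookup C i then c i else 0))
    where
    restrict : ∀ i → (if lookup C i then x i else 0ℚ) ≡ ℕ→ℚ (if lookup C i then c i else 0) * β
    restrict i with lookup C i
    ... | true  = x≡ i
    ... | false = sym (ℚ.*-zeroˡ β)

  objective≡ : ∀ G → objective G x ≡ ℕ→ℚ (degWeight G c) * β
  objective≡ G = trans (sumFin-cong weigh) (scaled-sum (λ i → deg G i ℕ.* c i))
    where
    weigh : ∀ i → ℕ→ℚ (deg G i) * x i ≡ ℕ→ℚ (deg G i ℕ.* c i) * β
    weigh i = trans (cong (ℕ→ℚ (deg G i) *_) (x≡ i)) (trans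
      (sym (ℚ.*-assoc (ℕ→ℚ (deg G i)) (ℕ→ℚ (c i)) β)) (cong (_* β) (sym (ℕ→ℚ-* (deg G i) (c i)))))

bool→ℚ-scaled : ∀ b → bool→ℚ b ≡ ℕ→ℚ (𝟙 b) * 1ℚ
bool→ℚ-scaled true  = refl
bool→ℚ-scaled false = refl

two-colours : ∀ (a b c : Bool) → a ≢ b → a ≢ c → b ≢ c → ⊥
two-colours true  true  _     a≢b _   _   = a≢b refl
two-colours false false _     a≢b _   _   = a≢b refl
two-colours true  false true  _   a≢c _   = a≢c refl
two-colours true  false false _   _   b≢c = b≢c refl
two-colours false true  false _   a≢c _   = a≢c refl
two-colours false true  true  _   _   b≢c = b≢c refl

pair-member : ∀ {n} {i j l : Fin n} → l ∈ ⁅ i ⁆ ∪ ⁅ j ⁆ → l ≡ i ⊎ l ≡ j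
pair-member {i = i} {j} l∈ij with x∈p∪q⁻ ⁅ i ⁆ ⁅ j ⁆ l∈ij
... | inj₁ l∈i = inj₁ (x∈⁅y⁆⇒x≡y i l∈i)
... | inj₂ l∈j = inj₂ (x∈⁅y⁆⇒x≡y j l∈j)

left∈pair : ∀ {n} (i j : Fin n) → i ∈ ⁅ i ⁆ ∪ ⁅ j ⁆
left∈pair i j = x∈p∪q⁺ (inj₁ (x∈⁅x⁆ i))

right∈pair : ∀ {n} (i j : Fin n) → j ∈ ⁅ i ⁆ ∪ ⁅ j ⁆
right∈pair i j = x∈p∪q⁺ {p = ⁅ i ⁆} (inj₂ (x∈⁅x⁆ j))

-- In a bipartite graph every edge is a maximal clique: a clique containing
-- the edge and a third vertex would need three colours.
edge-maximal-clique : ∀ {n} (G : Graph n) → Bipartite G → ∀ {i j} → Adj G i j ≡ true →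
  IsMaximalClique G (⁅ i ⁆ ∪ ⁅ j ⁆)
edge-maximal-clique {n} G (col , proper) {i} {j} edge = clique , maximal
  where
  adjacent : ∀ {a b : Fin n} → a ≡ i ⊎ a ≡ j → b ≡ i ⊎ b ≡ j → a ≢ b → Adj G a b ≡ true
  adjacent (inj₁ refl) (inj₁ refl) a≢b = ⊥-elim (a≢b refl)
  adjacent (inj₁ refl) (inj₂ refl) a≢b = edge
  adjacent (inj₂ refl) (inj₁ refl) a≢b = trans (Graph.sym G j i) edge
  adjacent (inj₂ refl) (inj₂ refl) a≢b = ⊥-elim (a≢b refl)

  clique : IsClique G (⁅ i ⁆ ∪ ⁅ j ⁆)
  clique a b a∈ b∈ = adjacent (pair-member a∈) (pair-member b∈)

  maximal : ∀ D → IsClique G D → ⁅ i ⁆ ∪ ⁅ j ⁆ ⊆ D → D ⊆ ⁅ i ⁆ ∪ ⁅ j ⁆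
  maximal D D-clique ij⊆D {l} l∈D with l ≟ i | l ≟ j
  ... | yes refl | _        = left∈pair i j
  ... | no _     | yes refl = right∈pair i j
  ... | no l≢i   | no l≢j   = ⊥-elim (two-colours (col l) (col i) (col j)
    (proper l i (D-clique l i l∈D (ij⊆D (left∈pair i j)) l≢i))
    (proper l j (D-clique l j l∈D (ij⊆D (right∈pair i j)) l≢j))
    (proper i j edge))

clique-colour-unique : ∀ {n} (G : Graph n) ((col , _) : Bipartite G) {C} → IsClique G C →
  ∀ {i j} → i ∈ C → j ∈ C → col i ≡ col j → i ≡ j
clique-colour-unique G (col , proper) C-clique {i} {j} i∈C j∈C same with i ≟ j
... | yes i≡j = i≡j
... | no  i≢j = ⊥-elim (proper i j (C-clique i j i∈C j∈C i≢j) same)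

-- A clique of a bipartite graph has at most one vertex of each colour, so its
-- h-weight is at most (max of h on one colour) + (max of h on the other).
clique-sum-bound : ∀ {n} (G : Graph n) ((col , _) : Bipartite G) {C} → IsClique G C →
  ∀ {a b} (h : Fin n → ℕ) → (∀ i → col i ≡ true → h i ℕ.≤ a) → (∀ i → not (col i) ≡ true → h i ℕ.≤ b) →
  sumOn C h ℕ.≤ a ℕ.+ b
clique-sum-bound {n} G bp@(col , _) {C} C-clique {a} {b} h ≤a ≤b = begin
  sumOn C h                                            ≡⟨ sum-partition col f ⟩
  sumFinℕ (part col) ℕ.+ sumFinℕ (part (not ∘ col))    ≤⟨ ℕ.+-mono-≤
    (colour-class col (λ i j cᵢ cⱼ → trans cᵢ (sym cⱼ)) ≤a)
    (colour-class (not ∘ col) (λ i j cᵢ cⱼ → not-injective (trans cᵢ (sym cⱼ))) ≤b) ⟩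
  a ℕ.+ b                                              ∎
  where
  open ℕ.≤-Reasoning
  f : Fin n → ℕ
  f i = if lookup C i then h i else 0

  part : (Fin n → Bool) → Fin n → ℕ
  part t i = if t i then f i else 0

  colour-class : ∀ {c} (t : Fin n → Bool) → (∀ i j → t i ≡ true → t j ≡ true → col i ≡ col j) →
    (∀ i → t i ≡ true → h i ℕ.≤ c) → sumFinℕ (part t) ℕ.≤ c
  colour-class {c} t monochrome bound = sum-≤-single (part t) unique term≤c
    where
    selected : ∀ i → 0 ℕ.< part t i → t i ≡ true × i ∈ C
    selected i pos with t i in tᵢ | lookup C i in i∈C
    ... | true  | true  = refl , lookup⇒[]= i C i∈C
    ... | true  | false = ⊥-elim (ℕ.<-irrefl refl pos)
    ... | false | _     = ⊥-elim (ℕ.<-irrefl refl pos)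

    unique : ∀ i j → 0 ℕ.< part t i → 0 ℕ.< part t j → i ≡ j
    unique i j posᵢ posⱼ with selected i posᵢ | selected j posⱼ
    ... | tᵢ , i∈C | tⱼ , j∈C = clique-colour-unique G bp C-clique i∈C j∈C (monochrome i j tᵢ tⱼ)

    term≤c : ∀ i → part t i ℕ.≤ c
    term≤c i with t i in tᵢ | lookup C i
    ... | true  | true  = bound i tᵢ
    ... | true  | false = z≤n
    ... | false | _     = z≤n

module Chosen {n} (y : Fin n → Bool) =
  Scaled (λ i → bool→ℚ (y i)) (λ i → 𝟙 (y i)) 1ℚ (λ i → bool→ℚ-scaled (y i))

ip-size : ∀ {n} (G : Graph n) {k} y → IPFeasible G k y → sumFinℕ (λ i → 𝟙 (y i)) ℕ.≤ k
ip-size G y (budget , _) = ℕ→ℚ-cancel (subst (_≤ _) (trans total (ℚ.*-identityʳ _)) budget)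
  where open Chosen y

-- In a bipartite graph the clique constraint of an edge forbids choosing
-- both of its ends: a feasible 0/1 vector is an independent set.
ip-independent : ∀ {n} (G : Graph n) → Bipartite G → ∀ {k} y → IPFeasible G k y →
  ∀ i j → Adj G i j ≡ true → y i ≡ true → y j ≡ true → ⊥
ip-independent {n} G bp y (_ , clique-constraint) i j edge yᵢ yⱼ =
  ℕ.<⇒≱ (s≤s (s≤s z≤n)) (ℕ.≤-trans both-chosen at-most-one)
  where
  open Chosen y
  C : Subset n
  C = ⁅ i ⁆ ∪ ⁅ j ⁆

  at-most-one : sumOn C (λ l → 𝟙 (y l)) ℕ.≤ 1
  at-most-one = ℕ→ℚ-cancel (subst (_≤ 1ℚ) (trans (onSubset C) (ℚ.*-identityʳ _))
    (clique-constraint C (edge-maximal-clique G bp edge)))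

  counted : ∀ l → l ∈ C → y l ≡ true → (if lookup C l then 𝟙 (y l) else 0) ≡ 1
  counted l l∈C yₗ rewrite []=⇒lookup l∈C | yₗ = refl

  i≢j : i ≢ j
  i≢j refl with trans (sym (Graph.irrefl G i)) edge
  ... | ()

  both-chosen : 2 ℕ.≤ sumOn C (λ l → 𝟙 (y l))
  both-chosen = subst (ℕ._≤ sumOn C (λ l → 𝟙 (y l)))
    (cong₂ ℕ._+_ (counted i (left∈pair i j) yᵢ) (counted j (right∈pair i j) yⱼ))
    (pair≤sum (λ l → if lookup C l then 𝟙 (y l) else 0) i j i≢j)

ip-objective : ∀ {n} (G : Graph n) y → objective G (λ i → bool→ℚ (y i)) ≡ ℕ→ℚ (degWeight G (λ i → 𝟙 (y i)))
ip-objective G y = trans (objective≡ G) (ℚ.*-identityʳ _)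
  where open Chosen y

module Construction (P : ℕ) where

  M B n : ℕ
  M = suc P
  B = suc M ℕ.* M
  n = suc (B ℕ.* M)

  data Kind : Set where
    hub        : Kind
    child leaf : Fin B → Kind

  -- Vertex 0 is the hub; vertex 1 + combine b r is v_b for r = 0 and one of
  -- the P leaves of v_b otherwise.
  below : Fin B × Fin M → Kind
  below (b , Fin.zero)  = child b
  below (b , Fin.suc _) = leaf b

  kind : Fin n → Kind
  kind Fin.zero    = hub
  kind (Fin.suc j) = below (remQuot M j)

  adjK : Kind → Kind → Bool
  adjK hub       (child _)  = true
  adjK (child _) hub        = true
  adjK (child b) (leaf b′)  = does (b ≟ b′)
  adjK (leaf b)  (child b′) = does (b′ ≟ b)
  adjK _         _          = false

  adjK-irrefl : ∀ κ → adjK κ κ ≡ false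
  adjK-irrefl hub       = refl
  adjK-irrefl (child _) = refl
  adjK-irrefl (leaf _)  = refl

  adjK-sym : ∀ κ κ′ → adjK κ κ′ ≡ adjK κ′ κ
  adjK-sym hub       hub       = refl
  adjK-sym hub       (child _) = refl
  adjK-sym hub       (leaf _)  = refl
  adjK-sym (child _) hub       = refl
  adjK-sym (child _) (child _) = refl
  adjK-sym (child _) (leaf _)  = refl
  adjK-sym (leaf _)  hub       = refl
  adjK-sym (leaf _)  (child _) = refl
  adjK-sym (leaf _)  (leaf _)  = refl

  G : Graph n
  G = record
    { Adj    = λ i j → adjK (kind i) (kind j)
    ; irrefl = λ i → adjK-irrefl (kind i)
    ; sym    = λ i j → adjK-sym (kind i) (kind j)
    }

  colour : Kind → Bool
  colour hub       = true
  colour (child _) = false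
  colour (leaf _)  = true

  bipartite : Bipartite G
  bipartite = (λ i → colour (kind i)) , λ i j → proper (kind i) (kind j)
    where
    proper : ∀ κ κ′ → adjK κ κ′ ≡ true → colour κ ≢ colour κ′
    proper hub       (child _) _ ()
    proper (child _) hub       _ ()
    proper (child _) (leaf _)  _ ()
    proper (leaf _)  (child _) _ ()

  sum-by-kind : (g : Kind → ℕ) →
    sumFinℕ (λ i → g (kind i)) ≡ g hub ℕ.+ sumFinℕ {B} (λ b → g (child b) ℕ.+ P ℕ.* g (leaf b))
  sum-by-kind g = cong (g hub ℕ.+_) (trans (sum-combine B (λ j → g (kind (Fin.suc j))))
    (sum-cong λ b → trans (sum-cong λ r → cong (λ p → g (below p)) (remQuot-combine b r))
                          (cong (g (child b) ℕ.+_) (sum-const P (g (leaf b))))))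

  -- B children, each followed by P leaves of weight 0.
  children-count : sumFinℕ {B} (λ _ → 1 ℕ.+ P ℕ.* 0) ≡ B
  children-count = trans (sum-cong {B} (λ _ → cong suc (ℕ.*-zeroʳ P)))
                         (trans (sum-const B 1) (ℕ.*-identityʳ B))

  -- The degree of a vertex only depends on its kind: deg G i = degK (kind i).
  degK : Kind → ℕ
  degK κ = sumFinℕ (λ j → 𝟙 (adjK κ (kind j)))

  deg-hub : degK hub ≡ B
  deg-hub = trans (sum-by-kind (λ κ → 𝟙 (adjK hub κ))) children-count

  -- v_b is adjacent to the hub and to its own P leaves.
  deg-child : ∀ b → degK (child b) ≡ M
  deg-child b = begin
    degK (child b)                                ≡⟨ sum-by-kind (λ κ → 𝟙 (adjK (child b) κ)) ⟩
    suc (sumFinℕ (λ b′ → P ℕ.* 𝟙 (does (b ≟ b′)))) ≡⟨ cong suc (sum-point _ b own-leaves) ⟩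
    suc (P ℕ.* 𝟙 (does (b ≟ b)))                  ≡⟨ cong (λ e → suc (P ℕ.* 𝟙 e)) (dec-true (b ≟ b) refl) ⟩
    suc (P ℕ.* 1)                                 ≡⟨ cong suc (ℕ.*-identityʳ P) ⟩
    M                                             ∎
    where
    open ≡-Reasoning
    own-leaves : ∀ b′ → b′ ≢ b → P ℕ.* 𝟙 (does (b ≟ b′)) ≡ 0
    own-leaves b′ b′≢b =
      trans (cong (λ e → P ℕ.* 𝟙 e) (dec-false (b ≟ b′) (λ b≡b′ → b′≢b (sym b≡b′)))) (ℕ.*-zeroʳ P)

  -- A leaf below v_b is adjacent to v_b only.
  deg-leaf : ∀ b → degK (leaf b) ≡ 1
  deg-leaf b = begin
    degK (leaf b)                                 ≡⟨ sum-by-kind (λ κ → 𝟙 (adjK (leaf b) κ)) ⟩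
    sumFinℕ (λ b′ → 𝟙 (does (b′ ≟ b)) ℕ.+ P ℕ.* 0) ≡⟨ sum-point _ b own-parent ⟩
    𝟙 (does (b ≟ b)) ℕ.+ P ℕ.* 0                  ≡⟨ cong₂ (λ e z → 𝟙 e ℕ.+ z) (dec-true (b ≟ b) refl) (ℕ.*-zeroʳ P) ⟩
    1                                             ∎
    where
    open ≡-Reasoning
    own-parent : ∀ b′ → b′ ≢ b → 𝟙 (does (b′ ≟ b)) ℕ.+ P ℕ.* 0 ≡ 0
    own-parent b′ b′≢b = cong₂ (λ e z → 𝟙 e ℕ.+ z) (dec-false (b′ ≟ b) b′≢b) (ℕ.*-zeroʳ P)

  deg-below : ∀ p → degK (below p) ℕ.≤ M
  deg-below (b , Fin.zero)  = ℕ.≤-reflexive (deg-child b)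
  deg-below (b , Fin.suc _) = ℕ.≤-trans (ℕ.≤-reflexive (deg-leaf b)) (s≤s z≤n)

  hub-neighbour-or-leaf : ∀ p → adjK hub (below p) ≡ true ⊎ degK (below p) ≡ 1
  hub-neighbour-or-leaf (b , Fin.zero)  = inj₁ refl
  hub-neighbour-or-leaf (b , Fin.suc _) = inj₂ (deg-leaf b)

  lpWeight : Kind → ℕ
  lpWeight hub       = M
  lpWeight (child _) = 1
  lpWeight (leaf _)  = 0

  x : Fin n → ℚ
  x i = ℕ→ℚ (lpWeight (kind i)) * inv-suc M

  open Scaled x (λ i → lpWeight (kind i)) (inv-suc M) (λ _ → refl)

  lp-budget : sumFinℕ (λ i → lpWeight (kind i)) ℕ.≤ suc M ℕ.* suc M
  lp-budget = begin
    sumFinℕ (λ i → lpWeight (kind i))          ≡⟨ sum-by-kind lpWeight ⟩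
    M ℕ.+ sumFinℕ {B} (λ _ → 1 ℕ.+ P ℕ.* 0)    ≡⟨ cong (M ℕ.+_) children-count ⟩
    M ℕ.+ suc M ℕ.* M                          ≤⟨ ℕ.n≤1+n _ ⟩
    suc (M ℕ.+ suc M ℕ.* M)                    ≡⟨ square M ⟩
    suc M ℕ.* suc M                            ∎
    where
    open ℕ.≤-Reasoning
    square : ∀ m → suc (m ℕ.+ suc m ℕ.* m) ≡ suc m ℕ.* suc m
    square = solve-∀

  -- A clique holds at most one vertex on the hub's side (weight ≤ M) and
  -- at most one child (weight 1).
  lp-clique : ∀ C → IsClique G C → sumOn C (λ i → lpWeight (kind i)) ℕ.≤ 1 ℕ.* suc M
  lp-clique C C-clique = ℕ.≤-trans
    (clique-sum-bound G bipartite C-clique (λ i → lpWeight (kind i))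
      (λ i → on-hub-side (kind i)) (λ i → on-child-side (kind i)))
    (ℕ.≤-reflexive (trans (ℕ.+-comm M 1) (sym (ℕ.*-identityˡ (suc M)))))
    where
    on-hub-side : ∀ κ → colour κ ≡ true → lpWeight κ ℕ.≤ M
    on-hub-side hub      _ = ℕ.≤-refl
    on-hub-side (leaf _) _ = z≤n
    on-child-side : ∀ κ → not (colour κ) ≡ true → lpWeight κ ℕ.≤ 1
    on-child-side (child _) _ = ℕ.≤-refl

  lp-feasible : LPFeasible G (suc M) x
  lp-feasible = (λ i → ÷suc-nonNeg M (lpWeight (kind i)))
              , subst (_≤ ℕ→ℚ (suc M)) (sym total) (÷suc-≤ M {b = suc M} lp-budget)
              , λ C C-max → subst (_≤ 1ℚ) (sym (onSubset C)) (÷suc-≤ M {b = 1} (lp-clique C (proj₁ C-max)))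

  -- The LP value: deg u · M + B · deg v_b · 1 = 2BM = 2M²·(M+1), scaled by 1/(M+1).
  lp-value : degWeight G (λ i → lpWeight (kind i)) ≡ (M ℕ.* M ℕ.+ M ℕ.* M) ℕ.* suc M
  lp-value = begin
    degWeight G (λ i → lpWeight (kind i))  ≡⟨ sum-by-kind (λ κ → degK κ ℕ.* lpWeight κ) ⟩
    degK hub ℕ.* M ℕ.+ sumFinℕ {B} (λ b → degK (child b) ℕ.* 1 ℕ.+ P ℕ.* (degK (leaf b) ℕ.* 0))
                                          ≡⟨ cong₂ ℕ._+_ (cong (ℕ._* M) deg-hub) (sum-cong child-term) ⟩
    B ℕ.* M ℕ.+ sumFinℕ {B} (λ _ → M)     ≡⟨ cong (B ℕ.* M ℕ.+_) (sum-const B M) ⟩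
    B ℕ.* M ℕ.+ B ℕ.* M                   ≡⟨ rearrange M ⟩
    (M ℕ.* M ℕ.+ M ℕ.* M) ℕ.* suc M       ∎
    where
    open ≡-Reasoning
    child-term : ∀ b → degK (child b) ℕ.* 1 ℕ.+ P ℕ.* (degK (leaf b) ℕ.* 0) ≡ M
    child-term b = trans (cong₂ ℕ._+_ (trans (ℕ.*-identityʳ _) (deg-child b))
                                      (trans (cong (P ℕ.*_) (ℕ.*-zeroʳ (degK (leaf b)))) (ℕ.*-zeroʳ P)))
                         (ℕ.+-identityʳ M)
    rearrange : ∀ m → suc m ℕ.* m ℕ.* m ℕ.+ suc m ℕ.* m ℕ.* m ≡ (m ℕ.* m ℕ.+ m ℕ.* m) ℕ.* suc m
    rearrange = solve-∀

  lp-objective : objective G x ≡ ℕ→ℚ (M ℕ.* M ℕ.+ M ℕ.* M)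
  lp-objective = trans (objective≡ G) (trans (cong (λ v → ℕ→ℚ v * inv-suc M) lp-value)
    (÷suc-cancel M (M ℕ.* M ℕ.+ M ℕ.* M)))

  module IntegralSolution (y : Fin n → Bool) (feasible : IPFeasible G (suc M) y) where

    open ℕ.≤-Reasoning

    rest : Fin (B ℕ.* M) → ℕ
    rest j = 𝟙 (y (Fin.suc j))

    -- With the hub chosen its neighbours are not, so every other chosen
    -- vertex is a leaf; and the hub uses one unit of the budget.
    hub-chosen : y Fin.zero ≡ true → degWeight G (λ i → 𝟙 (y i)) ℕ.≤ B ℕ.+ M
    hub-chosen y₀ = begin
      degK hub ℕ.* 𝟙 (y Fin.zero) ℕ.+ sumFinℕ (λ j → degK (kind (Fin.suc j)) ℕ.* rest j)
        ≡⟨ cong (λ c → degK hub ℕ.* 𝟙 c ℕ.+ sumFinℕ (λ j → degK (kind (Fin.suc j)) ℕ.* rest j)) y₀ ⟩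
      degK hub ℕ.* 1 ℕ.+ sumFinℕ (λ j → degK (kind (Fin.suc j)) ℕ.* rest j)
        ≤⟨ ℕ.+-mono-≤ (ℕ.≤-reflexive (trans (ℕ.*-identityʳ (degK hub)) deg-hub))
                      (weighted-count (λ j → degK (kind (Fin.suc j))) (λ j → y (Fin.suc j)) leaf-like) ⟩
      B ℕ.+ 1 ℕ.* sumFinℕ rest
        ≤⟨ ℕ.+-monoʳ-≤ B (ℕ.≤-trans (ℕ.≤-reflexive (ℕ.*-identityˡ _)) rest-size) ⟩
      B ℕ.+ M ∎
      where
      leaf-like : ∀ j → y (Fin.suc j) ≡ true → degK (kind (Fin.suc j)) ℕ.≤ 1
      leaf-like j yⱼ with hub-neighbour-or-leaf (remQuot M j)
      ... | inj₁ edge  = ⊥-elim (ip-independent G bipartite {suc M} y feasible Fin.zero (Fin.suc j) edge y₀ yⱼ)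
      ... | inj₂ deg≡1 = ℕ.≤-reflexive deg≡1

      rest-size : sumFinℕ rest ℕ.≤ M
      rest-size = ℕ.s≤s⁻¹ (subst (λ c → 𝟙 c ℕ.+ sumFinℕ rest ℕ.≤ suc M) y₀ (ip-size G {suc M} y feasible))

    -- Without the hub every chosen vertex has degree at most M, and at most
    -- M + 1 vertices are chosen.
    hub-free : y Fin.zero ≡ false → degWeight G (λ i → 𝟙 (y i)) ℕ.≤ M ℕ.* suc M
    hub-free y₀ = begin
      degWeight G (λ i → 𝟙 (y i))   ≤⟨ weighted-count (deg G) y degree≤M ⟩
      M ℕ.* sumFinℕ (λ i → 𝟙 (y i)) ≤⟨ ℕ.*-monoʳ-≤ M (ip-size G {suc M} y feasible) ⟩
      M ℕ.* suc M                   ∎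
      where
      degree≤M : ∀ i → y i ≡ true → deg G i ℕ.≤ M
      degree≤M Fin.zero    y₀≡true with trans (sym y₀) y₀≡true
      ... | ()
      degree≤M (Fin.suc j) _ = deg-below (remQuot M j)

  B+M≡ : B ℕ.+ M ≡ M ℕ.* M ℕ.+ (M ℕ.+ M)
  B+M≡ = identity M
    where
    identity : ∀ m → suc m ℕ.* m ℕ.+ m ≡ m ℕ.* m ℕ.+ (m ℕ.+ m)
    identity = solve-∀

  ip-bound : ∀ y → IPFeasible G (suc M) y → degWeight G (λ i → 𝟙 (y i)) ℕ.≤ M ℕ.* M ℕ.+ (M ℕ.+ M)
  ip-bound y feasible = subst (degWeight G (λ i → 𝟙 (y i)) ℕ.≤_) B+M≡ (by-hub (y Fin.zero) refl)
    where
    open IntegralSolution y feasible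
    by-hub : ∀ b → y Fin.zero ≡ b → degWeight G (λ i → 𝟙 (y i)) ℕ.≤ B ℕ.+ M
    by-hub true  y₀ = hub-chosen y₀
    by-hub false y₀ = ℕ.≤-trans (hub-free y₀)
      (ℕ.≤-trans (ℕ.≤-reflexive (ℕ.*-comm M (suc M))) (ℕ.m≤m+n B M))

half+ε-bound : ∀ m ε → 1ℚ ≤ ε * ℕ→ℚ m →
  ℕ→ℚ (m ℕ.* m ℕ.+ (m ℕ.+ m)) ≤ (½ + ε) * ℕ→ℚ (m ℕ.* m ℕ.+ m ℕ.* m)
half+ε-bound m ε εm≥1 = begin
  ℕ→ℚ (m ℕ.* m ℕ.+ (m ℕ.+ m))          ≡⟨ ℕ→ℚ-+ (m ℕ.* m) (m ℕ.+ m) ⟩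
  m² + ℕ→ℚ (m ℕ.+ m)                   ≤⟨ ℚ.+-monoʳ-≤ m² grow ⟩
  m² + ε * ℕ→ℚ m * ℕ→ℚ (m ℕ.+ m)       ≡⟨ cong₂ _+_ (sym (half m²)) (ℚ.*-assoc ε (ℕ→ℚ m) (ℕ→ℚ (m ℕ.+ m))) ⟩
  ½ * (m² + m²) + ε * (ℕ→ℚ m * ℕ→ℚ (m ℕ.+ m))
                                       ≡⟨ cong₂ (λ s t → ½ * s + ε * t) (sym (ℕ→ℚ-+ (m ℕ.* m) (m ℕ.* m)))
                                                (trans (sym (ℕ→ℚ-* m (m ℕ.+ m))) (cong ℕ→ℚ (ℕ.*-distribˡ-+ m m m))) ⟩
  ½ * 2m² + ε * 2m²                    ≡⟨ sym (ℚ.*-distribʳ-+ 2m² ½ ε) ⟩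
  (½ + ε) * 2m²                        ∎
  where
  open ℚ.≤-Reasoning
  m² 2m² : ℚ
  m²  = ℕ→ℚ (m ℕ.* m)
  2m² = ℕ→ℚ (m ℕ.* m ℕ.+ m ℕ.* m)

  half : ∀ q → ½ * (q + q) ≡ q
  half q = trans (ℚ.*-distribˡ-+ ½ q q) (trans (sym (ℚ.*-distribʳ-+ q ½ ½)) (ℚ.*-identityˡ q))

  grow : ℕ→ℚ (m ℕ.+ m) ≤ ε * ℕ→ℚ m * ℕ→ℚ (m ℕ.+ m)
  grow = subst (_≤ ε * ℕ→ℚ m * ℕ→ℚ (m ℕ.+ m)) (ℚ.*-identityˡ (ℕ→ℚ (m ℕ.+ m)))
    (ℚ.*-monoʳ-≤-nonNeg (ℕ→ℚ (m ℕ.+ m)) {{ℕ→ℚ-nonNeg (m ℕ.+ m)}} εm≥1)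

mainTheorem11 : (ε : ℚ) → 0ℚ < ε →
    Σ ℕ λ n → Σ (Graph n) λ G → Bipartite G × Σ ℕ λ k → (1 Data.Nat.≤ k) ×
      Σ (Fin n → ℚ) λ x → LPFeasible G k x × (0ℚ < objective G x) ×
        ((y : Fin n → Bool) → IPFeasible G k y →
          objective G (λ i → bool→ℚ (y i)) ≤ (½ + ε) * objective G x)
mainTheorem11 ε ε>0 = n , G , bipartite , suc M , s≤s z≤n , x , lp-feasible , lp-positive , gap
  where
  open Construction (ℚ.denominator-1 ε)
  open ℚ.≤-Reasoning

  lp-positive : 0ℚ < objective G x
  lp-positive = subst (0ℚ <_) (sym lp-objective) (ℕ→ℚ-pos {M ℕ.* M ℕ.+ M ℕ.* M} (s≤s z≤n))

  gap : (y : Fin n → Bool) → IPFeasible G (suc M) y → objective G (λ i → bool→ℚ (y i)) ≤ (½ + ε) * objective G x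
  gap y feasible = begin
    objective G (λ i → bool→ℚ (y i))     ≡⟨ ip-objective G y ⟩
    ℕ→ℚ (degWeight G (λ i → 𝟙 (y i)))    ≤⟨ ℕ→ℚ-mono {b = M ℕ.* M ℕ.+ (M ℕ.+ M)} (ip-bound y feasible) ⟩
    ℕ→ℚ (M ℕ.* M ℕ.+ (M ℕ.+ M))          ≤⟨ half+ε-bound M ε (ε*denominator≥1 ε ε>0) ⟩
    (½ + ε) * ℕ→ℚ (M ℕ.* M ℕ.+ M ℕ.* M)  ≡⟨ cong ((½ + ε) *_) (sym lp-objective) ⟩
    (½ + ε) * objective G x              ∎
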